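{- Let $A,B\in\mathbb{Z}$ with $AB\neq 0$, and for integers $n\ge 2$ let \[\mathcal{F}_{n,A,B}(x)=x^{2^n}+Ax^{3\cdot 2^{n-2}}+Bx^{2^{n-1}}+Ax^{2^{n-2}}+1.\] If $\mathcal{F}_{n,A,B}(x)$ is monogenic for some $n\ge 3$, then $\mathcal{F}_{n-1,A,B}(x)$ is monogenic.
   Context: A monic polynomial $f(x)\in\mathbb{Z}[x]$ is called monogenic if $f(x)$ is irreducible over $\mathbb{Q}$ and $\{1,\theta,\ldots,\theta^{\deg f-1}\}$ is a $\mathbb{Z}$-basis of the ring of integers of $\mathbb{Q}(\theta)$, where $f(\theta)=0$. -}

module Defs where

open import Data.Nat using (ℕ; zero; suc; _∸_; _^_)
import Data.Nat as ℕ
open import Data.Integer using (ℤ; +_)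
import Data.Integer as ℤ
open import Data.Rational using (ℚ; 0ℚ; _/_)
import Data.Rational as ℚ
open import Data.List using (List; []; _∷_; _++_; map; replicate; foldr; length)
open import Data.Vec using (Vec; toList)
open import Data.Vec.Relation.Unary.All using (All)
open import Data.Product using (Σ; ∃; _×_; _,_)
open import Data.Sum using (_⊎_)
open import Relation.Nullary using (¬_)
open import Relation.Binary.PropositionalEquality using (_≡_)

-- Polynomials are coefficient lists, lowest degree first.

_⊕ᶻ_ : List ℤ → List ℤ → List ℤ
[] ⊕ᶻ q = q
(a ∷ p) ⊕ᶻ [] = a ∷ p
(a ∷ p) ⊕ᶻ (b ∷ q) = (a ℤ.+ b) ∷ (p ⊕ᶻ q)

monoᶻ : ℤ → ℕ → List ℤ
monoᶻ c k = replicate k (+ 0) ++ (c ∷ [])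

F : ℕ → ℤ → ℤ → List ℤ
F n A B =
  monoᶻ (+ 1) (2 ^ n) ⊕ᶻ (monoᶻ A (3 ℕ.* 2 ^ (n ∸ 2)) ⊕ᶻ (monoᶻ B (2 ^ (n ∸ 1))
    ⊕ᶻ (monoᶻ A (2 ^ (n ∸ 2)) ⊕ᶻ monoᶻ (+ 1) 0)))

toℚ : ℤ → ℚ
toℚ z = z / 1

toℚ[x] : List ℤ → List ℚ
toℚ[x] = map toℚ

_⊕_ : List ℚ → List ℚ → List ℚ
[] ⊕ q = q
(a ∷ p) ⊕ [] = a ∷ p
(a ∷ p) ⊕ (b ∷ q) = (a ℚ.+ b) ∷ (p ⊕ q)

scale : ℚ → List ℚ → List ℚ
scale c = map (c ℚ.*_)

_⊗_ : List ℚ → List ℚ → List ℚ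
[] ⊗ q = []
(a ∷ p) ⊗ q = scale a q ⊕ (0ℚ ∷ (p ⊗ q))

_⊖_ : List ℚ → List ℚ → List ℚ
p ⊖ q = p ⊕ scale (ℚ.- ℚ.1ℚ) q

coeff : List ℚ → ℕ → ℚ
coeff [] i = 0ℚ
coeff (a ∷ p) zero = a
coeff (a ∷ p) (suc i) = coeff p i

-- equality of polynomials (ignoring trailing zeros)
_≈ₚ_ : List ℚ → List ℚ → Set
p ≈ₚ q = ∀ i → coeff p i ≡ coeff q i

_∣ₚ_ : List ℚ → List ℚ → Set
f ∣ₚ p = ∃ λ q → p ≈ₚ (f ⊗ q)

IsConstant : List ℚ → Set
IsConstant p = ∀ i → coeff p (suc i) ≡ 0ℚ

Irreducible : List ℚ → Set
Irreducible f = ¬ IsConstant f × (∀ g h → f ≈ₚ (g ⊗ h) → IsConstant g ⊎ IsConstant h)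

-- The number field ℚ(θ) ≅ ℚ[x]/(f), θ ↦ x; an element is represented by r ∈ ℚ[x].

evalAt : List ℤ → List ℚ → List ℚ
evalAt g r = foldr (λ c acc → (toℚ c ∷ []) ⊕ (r ⊗ acc)) [] g

-- r (mod f) is an algebraic integer: root of a monic integer polynomial cs ++ [1]
IsIntegral : List ℚ → List ℚ → Set
IsIntegral f r = ∃ λ (cs : List ℤ) → f ∣ₚ evalAt (cs ++ (+ 1 ∷ [])) r

-- a : Vec ℤ d as the element a₀ + a₁θ + … + a_{d-1}θ^{d-1}
comb : ∀ {d} → Vec ℤ d → List ℚ
comb a = toℚ[x] (toList a)

-- {1, θ, …, θ^{d-1}} is a ℤ-basis of the ring of integers of ℚ(θ) = ℚ[x]/(f):
-- its ℤ-span is exactly the set of integral elements, and it is ℤ-linearly independent.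
IsIntegralBasis : List ℚ → ℕ → Set
IsIntegralBasis f d =
  (∀ r → IsIntegral f r → ∃ λ (a : Vec ℤ d) → f ∣ₚ (r ⊖ comb a)) ×
  (∀ (a : Vec ℤ d) r → f ∣ₚ (r ⊖ comb a) → IsIntegral f r) ×
  (∀ (a : Vec ℤ d) → f ∣ₚ comb a → All (_≡ + 0) a)

-- monogenic: monic (f = g ++ [1], so deg f = length g), irreducible over ℚ,
-- and the powers of θ form an integral basis.
Monogenic : List ℤ → Set
Monogenic f = Σ (List ℤ) λ g → (f ≡ g ++ (+ 1 ∷ [])) ×
  Irreducible (toℚ[x] f) × IsIntegralBasis (toℚ[x] f) (length g)

-- F_{n,A,B}(x) = F_{n-1,A,B}(x²), so with f = F_{n-1} the field ℚ[x]/(f(x²)) contains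
-- ℚ[x]/(f) via p(x) ↦ p(x²), and taking even parts p ↦ Σ p_{2i} x^i is a left inverse
-- of this embedding with evenPart (f(x²) · q) = f · evenPart q.  Hence a factorisation
-- of f dilates to one of f(x²), integrality and divisibility by f are equivalent to
-- integrality and divisibility by f(x²) after dilation, and a representation in the basis
-- 1, x, …, x^{2d-1} of ℚ[x]/(f(x²)) restricts, by taking even parts, to one in the basis
-- 1, x, …, x^{d-1} of ℚ[x]/(f).
module Submission where

open import Defs
open import Data.Nat using (ℕ; _≤_; _∸_)
open import Data.Integer using (ℤ; +_)
open import Relation.Nullary using (¬_)
open import Relation.Binary.PropositionalEquality using (_≡_)

open import Data.Nat using (zero; suc; _<_; _^_; z≤n; s≤s)
import Data.Nat as ℕ
import Data.Nat.Properties as ℕₚ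
import Data.Integer as ℤ
import Data.Integer.Properties as ℤₚ
open import Data.Rational using (ℚ; 0ℚ; 1ℚ)
import Data.Rational as ℚ
import Data.Rational.Properties as ℚₚ
open import Data.List using (List; []; _∷_; _++_; replicate; length)
import Data.List.Properties as Listₚ
open import Data.Vec using (Vec; []; _∷_)
open import Data.Vec.Relation.Unary.All using (All; []; _∷_)
open import Data.Product using (∃; _×_; _,_)
import Data.Sum as Sum
open import Relation.Binary using (Setoid)
import Relation.Binary.Reasoning.Setoid as SetoidReasoning
open import Relation.Binary.PropositionalEquality using (refl; sym; trans; cong; cong₂; subst; module ≡-Reasoning)

-- A record around _≈ₚ_, which unfolds to a Π-type from which Agda cannot infer p and q.
infix 4 _≅_
record _≅_ (p q : List ℚ) : Set where
  constructor mk
  field coeff-≡ : p ≈ₚ q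
open _≅_

≅-refl : ∀ {p} → p ≅ p
≅-refl = mk λ _ → refl

≅-sym : ∀ {p q} → p ≅ q → q ≅ p
≅-sym e = mk λ i → sym (coeff-≡ e i)

≅-trans : ∀ {p q r} → p ≅ q → q ≅ r → p ≅ r
≅-trans e e′ = mk λ i → trans (coeff-≡ e i) (coeff-≡ e′ i)

≅-setoid : Setoid _ _
≅-setoid = record
  { Carrier = List ℚ
  ; _≈_ = _≅_
  ; isEquivalence = record { refl = ≅-refl ; sym = ≅-sym ; trans = ≅-trans }
  }

module ≅-Reasoning = SetoidReasoning ≅-setoid

≡⇒≅ : ∀ {p q} → p ≡ q → p ≅ q
≡⇒≅ refl = ≅-refl

∷-cong : ∀ {a b p q} → a ≡ b → p ≅ q → a ∷ p ≅ b ∷ q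
∷-cong a≡b p≅q = mk λ { zero → a≡b ; (suc i) → coeff-≡ p≅q i }

[]≅∷ : ∀ {a p} → 0ℚ ≡ a → [] ≅ p → [] ≅ a ∷ p
[]≅∷ 0≡a []≅p = mk λ { zero → 0≡a ; (suc i) → coeff-≡ []≅p i }

[]≅∷⁻ : ∀ {a p} → [] ≅ a ∷ p → [] ≅ p
[]≅∷⁻ e = mk λ i → coeff-≡ e (suc i)

∷-injectiveʳ-≅ : ∀ {a b p q} → a ∷ p ≅ b ∷ q → p ≅ q
∷-injectiveʳ-≅ e = mk λ i → coeff-≡ e (suc i)

coeff-⊕ : ∀ p q i → coeff (p ⊕ q) i ≡ coeff p i ℚ.+ coeff q i
coeff-⊕ []      q       i       = sym (ℚₚ.+-identityˡ _)
coeff-⊕ (a ∷ p) []      i       = sym (ℚₚ.+-identityʳ _)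
coeff-⊕ (a ∷ p) (b ∷ q) zero    = refl
coeff-⊕ (a ∷ p) (b ∷ q) (suc i) = coeff-⊕ p q i

coeff-scale : ∀ c p i → coeff (scale c p) i ≡ c ℚ.* coeff p i
coeff-scale c []      i       = sym (ℚₚ.*-zeroʳ c)
coeff-scale c (a ∷ p) zero    = refl
coeff-scale c (a ∷ p) (suc i) = coeff-scale c p i

⊕-cong : ∀ {p p′ q q′} → p ≅ p′ → q ≅ q′ → p ⊕ q ≅ p′ ⊕ q′
⊕-cong {p} {p′} {q} {q′} e e′ = mk λ i → begin
  coeff (p ⊕ q) i             ≡⟨ coeff-⊕ p q i ⟩
  coeff p i ℚ.+ coeff q i     ≡⟨ cong₂ ℚ._+_ (coeff-≡ e i) (coeff-≡ e′ i) ⟩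
  coeff p′ i ℚ.+ coeff q′ i   ≡⟨ coeff-⊕ p′ q′ i ⟨
  coeff (p′ ⊕ q′) i           ∎
  where open ≡-Reasoning

scale-cong : ∀ c {p q} → p ≅ q → scale c p ≅ scale c q
scale-cong c {p} {q} e = mk λ i →
  trans (coeff-scale c p i) (trans (cong (c ℚ.*_) (coeff-≡ e i)) (sym (coeff-scale c q i)))

⊖-cong : ∀ {p p′ q q′} → p ≅ p′ → q ≅ q′ → p ⊖ q ≅ p′ ⊖ q′
⊖-cong e e′ = ⊕-cong e (scale-cong (ℚ.- 1ℚ) e′)

scale-zero : ∀ p → scale 0ℚ p ≅ []
scale-zero p = mk λ i → trans (coeff-scale 0ℚ p i) (ℚₚ.*-zeroˡ (coeff p i))

⊗-congʳ : ∀ p {q q′} → q ≅ q′ → p ⊗ q ≅ p ⊗ q′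
⊗-congʳ []      e = ≅-refl
⊗-congʳ (a ∷ p) e = ⊕-cong (scale-cong a e) (∷-cong refl (⊗-congʳ p e))

[]≅-⊗ : ∀ {p} q → [] ≅ p → [] ≅ p ⊗ q
[]≅-⊗ {[]}    q []≅p = ≅-refl
[]≅-⊗ {a ∷ p} q []≅p = begin
  []                              ≈⟨ []≅∷ refl ([]≅-⊗ q ([]≅∷⁻ []≅p)) ⟩
  0ℚ ∷ p ⊗ q                      ≈⟨ ⊕-cong (scale-zero q) ≅-refl ⟨
  scale 0ℚ q ⊕ (0ℚ ∷ p ⊗ q)       ≡⟨ cong (λ c → scale c q ⊕ (0ℚ ∷ p ⊗ q)) (coeff-≡ []≅p 0) ⟩
  scale a q ⊕ (0ℚ ∷ p ⊗ q)        ∎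
  where open ≅-Reasoning

⊗-congˡ : ∀ {p p′} q → p ≅ p′ → p ⊗ q ≅ p′ ⊗ q
⊗-congˡ {[]}    {p′}     q e = []≅-⊗ q e
⊗-congˡ {a ∷ p} {[]}     q e = ≅-sym ([]≅-⊗ q (≅-sym e))
⊗-congˡ {a ∷ p} {a′ ∷ p′} q e =
  ⊕-cong (≡⇒≅ (cong (λ c → scale c q) (coeff-≡ e 0))) (∷-cong refl (⊗-congˡ q (∷-injectiveʳ-≅ e)))

∣ₚ-resp-≅ : ∀ f {p p′} → p ≅ p′ → f ∣ₚ p → f ∣ₚ p′
∣ₚ-resp-≅ f p≅p′ (q , p≈fq) = q , coeff-≡ (≅-trans (≅-sym p≅p′) (mk {q = f ⊗ q} p≈fq))

IsConstant-resp-≅ : ∀ {p q} → p ≅ q → IsConstant p → IsConstant q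
IsConstant-resp-≅ e c i = trans (sym (coeff-≡ e (suc i))) (c i)

-- The substitution x ↦ x² and its left inverse, the even part

-- Recursive rather than 2 * n, so that Vec ℤ (double (suc d)) visibly starts with two entries.
double : ℕ → ℕ
double zero    = zero
double (suc n) = suc (suc (double n))

double≡2* : ∀ n → double n ≡ 2 ℕ.* n
double≡2* zero    = refl
double≡2* (suc n) =
  trans (cong (λ m → suc (suc m)) (double≡2* n)) (cong suc (sym (ℕₚ.+-suc n (n ℕ.+ 0))))

data Parity : ℕ → Set where
  even : ∀ i → Parity (double i)
  odd  : ∀ i → Parity (suc (double i))

parity : ∀ j → Parity j
parity zero = even zero
parity (suc j) with parity j
... | even i = odd i
... | odd i  = even (suc i)

infix 25 _∘x²
_∘x² : List ℚ → List ℚ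
[]      ∘x² = []
(a ∷ p) ∘x² = a ∷ 0ℚ ∷ p ∘x²

evenPart : List ℚ → List ℚ
evenPart []          = []
evenPart (a ∷ [])    = a ∷ []
evenPart (a ∷ _ ∷ p) = a ∷ evenPart p

coeff-∘x²-even : ∀ p i → coeff (p ∘x²) (double i) ≡ coeff p i
coeff-∘x²-even []      i       = refl
coeff-∘x²-even (a ∷ p) zero    = refl
coeff-∘x²-even (a ∷ p) (suc i) = coeff-∘x²-even p i

coeff-∘x²-odd : ∀ p i → coeff (p ∘x²) (suc (double i)) ≡ 0ℚ
coeff-∘x²-odd []      i       = refl
coeff-∘x²-odd (a ∷ p) zero    = refl
coeff-∘x²-odd (a ∷ p) (suc i) = coeff-∘x²-odd p i

coeff-evenPart : ∀ p i → coeff (evenPart p) i ≡ coeff p (double i)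
coeff-evenPart []          i       = refl
coeff-evenPart (a ∷ [])    zero    = refl
coeff-evenPart (a ∷ [])    (suc i) = refl
coeff-evenPart (a ∷ b ∷ p) zero    = refl
coeff-evenPart (a ∷ b ∷ p) (suc i) = coeff-evenPart p i

≅-∘x² : ∀ {X} p → (∀ i → coeff X (double i) ≡ coeff p i) →
  (∀ i → coeff X (suc (double i)) ≡ 0ℚ) → X ≅ p ∘x²
≅-∘x² p evens odds = mk λ j → at j (parity j)
  where
  at : ∀ j → Parity j → _
  at _ (even i) = trans (evens i) (sym (coeff-∘x²-even p i))
  at _ (odd i)  = trans (odds i) (sym (coeff-∘x²-odd p i))

∘x²-cong : ∀ {p q} → p ≅ q → p ∘x² ≅ q ∘x²
∘x²-cong {p} {q} e = ≅-∘x² q (λ i → trans (coeff-∘x²-even p i) (coeff-≡ e i)) (coeff-∘x²-odd p)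

∘x²-⊕ : ∀ p q → (p ⊕ q) ∘x² ≅ p ∘x² ⊕ q ∘x²
∘x²-⊕ p q = ≅-sym (≅-∘x² (p ⊕ q)
  (λ i → trans (coeff-⊕ (p ∘x²) (q ∘x²) (double i))
    (trans (cong₂ ℚ._+_ (coeff-∘x²-even p i) (coeff-∘x²-even q i)) (sym (coeff-⊕ p q i))))
  (λ i → trans (coeff-⊕ (p ∘x²) (q ∘x²) (suc (double i)))
    (trans (cong₂ ℚ._+_ (coeff-∘x²-odd p i) (coeff-∘x²-odd q i)) (ℚₚ.+-identityˡ 0ℚ))))

∘x²-scale : ∀ c p → (scale c p) ∘x² ≅ scale c (p ∘x²)
∘x²-scale c p = ≅-sym (≅-∘x² (scale c p)
  (λ i → trans (coeff-scale c (p ∘x²) (double i))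
    (trans (cong (c ℚ.*_) (coeff-∘x²-even p i)) (sym (coeff-scale c p i))))
  (λ i → trans (coeff-scale c (p ∘x²) (suc (double i)))
    (trans (cong (c ℚ.*_) (coeff-∘x²-odd p i)) (ℚₚ.*-zeroʳ c))))

∘x²-⊖ : ∀ p q → (p ⊖ q) ∘x² ≅ p ∘x² ⊖ q ∘x²
∘x²-⊖ p q = ≅-trans (∘x²-⊕ p (scale (ℚ.- 1ℚ) q)) (⊕-cong ≅-refl (∘x²-scale (ℚ.- 1ℚ) q))

∘x²-⊗ : ∀ p q → (p ⊗ q) ∘x² ≅ p ∘x² ⊗ q ∘x²
∘x²-⊗ []      q = ≅-refl
∘x²-⊗ (a ∷ p) q = begin
  (scale a q ⊕ (0ℚ ∷ p ⊗ q)) ∘x²                          ≈⟨ ∘x²-⊕ (scale a q) (0ℚ ∷ p ⊗ q) ⟩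
  (scale a q) ∘x² ⊕ (0ℚ ∷ 0ℚ ∷ (p ⊗ q) ∘x²)               ≈⟨ ⊕-cong (∘x²-scale a q)
                                                               (∷-cong refl (∷-cong refl (∘x²-⊗ p q))) ⟩
  scale a (q ∘x²) ⊕ (0ℚ ∷ 0ℚ ∷ p ∘x² ⊗ q ∘x²)             ≈⟨ ⊕-cong ≅-refl
                                                               (∷-cong refl (⊕-cong (scale-zero (q ∘x²)) ≅-refl)) ⟨
  scale a (q ∘x²) ⊕ (0ℚ ∷ (scale 0ℚ (q ∘x²) ⊕ (0ℚ ∷ p ∘x² ⊗ q ∘x²))) ∎
  where open ≅-Reasoning

∘x²-evalAt : ∀ g r → evalAt g (r ∘x²) ≅ (evalAt g r) ∘x²
∘x²-evalAt []      r = ≅-refl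
∘x²-evalAt (c ∷ g) r = begin
  (toℚ c ∷ []) ⊕ (r ∘x² ⊗ evalAt g (r ∘x²))      ≈⟨ ⊕-cong ≅-refl (⊗-congʳ (r ∘x²) (∘x²-evalAt g r)) ⟩
  (toℚ c ∷ []) ⊕ (r ∘x² ⊗ (evalAt g r) ∘x²)      ≈⟨ ⊕-cong (∷-cong refl (≅-sym ([]≅∷ refl ≅-refl)))
                                                      (∘x²-⊗ r (evalAt g r)) ⟨
  (toℚ c ∷ []) ∘x² ⊕ (r ⊗ evalAt g r) ∘x²        ≈⟨ ∘x²-⊕ (toℚ c ∷ []) (r ⊗ evalAt g r) ⟨
  ((toℚ c ∷ []) ⊕ (r ⊗ evalAt g r)) ∘x²          ∎
  where open ≅-Reasoning

evenPart-cong : ∀ {p q} → p ≅ q → evenPart p ≅ evenPart q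
evenPart-cong {p} {q} e = mk λ i →
  trans (coeff-evenPart p i) (trans (coeff-≡ e (double i)) (sym (coeff-evenPart q i)))

evenPart-⊕ : ∀ p q → evenPart (p ⊕ q) ≅ evenPart p ⊕ evenPart q
evenPart-⊕ p q = mk λ i → begin
  coeff (evenPart (p ⊕ q)) i                               ≡⟨ coeff-evenPart (p ⊕ q) i ⟩
  coeff (p ⊕ q) (double i)                                 ≡⟨ coeff-⊕ p q (double i) ⟩
  coeff p (double i) ℚ.+ coeff q (double i)                ≡⟨ cong₂ ℚ._+_ (coeff-evenPart p i) (coeff-evenPart q i) ⟨
  coeff (evenPart p) i ℚ.+ coeff (evenPart q) i            ≡⟨ coeff-⊕ (evenPart p) (evenPart q) i ⟨
  coeff (evenPart p ⊕ evenPart q) i                        ∎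
  where open ≡-Reasoning

evenPart-scale : ∀ c p → evenPart (scale c p) ≅ scale c (evenPart p)
evenPart-scale c p = mk λ i →
  trans (coeff-evenPart (scale c p) i) (trans (coeff-scale c p (double i))
    (trans (cong (c ℚ.*_) (sym (coeff-evenPart p i))) (sym (coeff-scale c (evenPart p) i))))

evenPart-⊖ : ∀ p q → evenPart (p ⊖ q) ≅ evenPart p ⊖ evenPart q
evenPart-⊖ p q = ≅-trans (evenPart-⊕ p (scale (ℚ.- 1ℚ) q)) (⊕-cong ≅-refl (evenPart-scale (ℚ.- 1ℚ) q))

evenPart-∘x² : ∀ p → evenPart (p ∘x²) ≅ p
evenPart-∘x² p = mk λ i → trans (coeff-evenPart (p ∘x²) i) (coeff-∘x²-even p i)

evenPart-∘x²-⊗ : ∀ f q → evenPart (f ∘x² ⊗ q) ≅ f ⊗ evenPart q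
evenPart-∘x²-⊗ []      q = ≅-refl
evenPart-∘x²-⊗ (a ∷ f) q = begin
  evenPart (scale a q ⊕ (0ℚ ∷ (scale 0ℚ q ⊕ (0ℚ ∷ f ∘x² ⊗ q))))
    ≈⟨ evenPart-cong (⊕-cong ≅-refl (∷-cong refl (⊕-cong (scale-zero q) ≅-refl))) ⟩
  evenPart (scale a q ⊕ (0ℚ ∷ 0ℚ ∷ f ∘x² ⊗ q))
    ≈⟨ evenPart-⊕ (scale a q) (0ℚ ∷ 0ℚ ∷ f ∘x² ⊗ q) ⟩
  evenPart (scale a q) ⊕ (0ℚ ∷ evenPart (f ∘x² ⊗ q))
    ≈⟨ ⊕-cong (evenPart-scale a q) (∷-cong refl (evenPart-∘x²-⊗ f q)) ⟩
  scale a (evenPart q) ⊕ (0ℚ ∷ f ⊗ evenPart q)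
    ∎
  where open ≅-Reasoning

∘x²-preserves-IsConstant : ∀ p → IsConstant p → IsConstant (p ∘x²)
∘x²-preserves-IsConstant p c j with parity j
... | even i = coeff-∘x²-odd p i
... | odd i  = trans (coeff-∘x²-even p (suc i)) (c i)

∘x²-reflects-IsConstant : ∀ p → IsConstant (p ∘x²) → IsConstant p
∘x²-reflects-IsConstant p c i = trans (sym (coeff-∘x²-even p (suc i))) (c (suc (double i)))

evens : ∀ {d} → Vec ℤ (double d) → Vec ℤ d
evens {zero}  []            = []
evens {suc d} (a ∷ _ ∷ as) = a ∷ evens as

spread : ∀ {d} → Vec ℤ d → Vec ℤ (double d)
spread []       = []
spread (a ∷ as) = a ∷ + 0 ∷ spread as

comb-evens : ∀ {d} (as : Vec ℤ (double d)) → comb (evens as) ≅ evenPart (comb as)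
comb-evens {zero}  []            = ≅-refl
comb-evens {suc d} (a ∷ _ ∷ as) = ∷-cong refl (comb-evens as)

comb-spread : ∀ {d} (as : Vec ℤ d) → comb (spread as) ≅ comb as ∘x²
comb-spread []       = ≅-refl
comb-spread (a ∷ as) = ∷-cong refl (∷-cong refl (comb-spread as))

All-spread⁻ : ∀ {P : ℤ → Set} {d} (as : Vec ℤ d) → All P (spread as) → All P as
All-spread⁻ []       []               = []
All-spread⁻ (a ∷ as) (pa ∷ _ ∷ pas) = pa ∷ All-spread⁻ as pas

-- Descent from f(x²) to f

module _ {f f₂ : List ℚ} (f₂≅f∘x² : f₂ ≅ f ∘x²) where

  ∘x²-∣ₚ : ∀ p → f ∣ₚ p → f₂ ∣ₚ p ∘x²
  ∘x²-∣ₚ p (q , p≈fq) = q ∘x² , coeff-≡ (begin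
    p ∘x²          ≈⟨ ∘x²-cong (mk {q = f ⊗ q} p≈fq) ⟩
    (f ⊗ q) ∘x²    ≈⟨ ∘x²-⊗ f q ⟩
    f ∘x² ⊗ q ∘x²  ≈⟨ ⊗-congˡ (q ∘x²) f₂≅f∘x² ⟨
    f₂ ⊗ q ∘x²     ∎)
    where open ≅-Reasoning

  evenPart-∣ₚ : ∀ p → f₂ ∣ₚ p → f ∣ₚ evenPart p
  evenPart-∣ₚ p (q , p≈f₂q) = evenPart q , coeff-≡ (begin
    evenPart p             ≈⟨ evenPart-cong (mk {q = f₂ ⊗ q} p≈f₂q) ⟩
    evenPart (f₂ ⊗ q)      ≈⟨ evenPart-cong (⊗-congˡ q f₂≅f∘x²) ⟩
    evenPart (f ∘x² ⊗ q)   ≈⟨ evenPart-∘x²-⊗ f q ⟩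
    f ⊗ evenPart q         ∎)
    where open ≅-Reasoning

  ∘x²-IsIntegral : ∀ r → IsIntegral f r → IsIntegral f₂ (r ∘x²)
  ∘x²-IsIntegral r (cs , f∣P[r]) =
    cs , ∣ₚ-resp-≅ f₂ (≅-sym (∘x²-evalAt (cs ++ + 1 ∷ []) r)) (∘x²-∣ₚ (evalAt (cs ++ + 1 ∷ []) r) f∣P[r])

  IsIntegral-of-∘x² : ∀ r → IsIntegral f₂ (r ∘x²) → IsIntegral f r
  IsIntegral-of-∘x² r (cs , f₂∣P[r∘x²]) = cs , ∣ₚ-resp-≅ f evenPart-P[r∘x²] (evenPart-∣ₚ (evalAt P (r ∘x²)) f₂∣P[r∘x²])
    where
    P = cs ++ + 1 ∷ []
    evenPart-P[r∘x²] : evenPart (evalAt P (r ∘x²)) ≅ evalAt P r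
    evenPart-P[r∘x²] = ≅-trans (evenPart-cong (∘x²-evalAt P r)) (evenPart-∘x² (evalAt P r))

  irreducible-of-∘x² : Irreducible f₂ → Irreducible f
  irreducible-of-∘x² (nonconstant , split) =
    (λ c → nonconstant (IsConstant-resp-≅ (≅-sym f₂≅f∘x²) (∘x²-preserves-IsConstant f c))) ,
    λ g h f≈gh → Sum.map (∘x²-reflects-IsConstant g) (∘x²-reflects-IsConstant h)
      (split (g ∘x²) (h ∘x²) (coeff-≡ (begin
        f₂              ≈⟨ f₂≅f∘x² ⟩
        f ∘x²           ≈⟨ ∘x²-cong (mk {q = g ⊗ h} f≈gh) ⟩
        (g ⊗ h) ∘x²     ≈⟨ ∘x²-⊗ g h ⟩
        g ∘x² ⊗ h ∘x²   ∎)))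
    where open ≅-Reasoning

  integralBasis-of-∘x² : ∀ {d} → IsIntegralBasis f₂ (double d) → IsIntegralBasis f d
  integralBasis-of-∘x² (spanning , integral , independent) =
    (λ r r-integral →
      let as , f₂∣r∘x²-as = spanning (r ∘x²) (∘x²-IsIntegral r r-integral)
      in evens as , ∣ₚ-resp-≅ f (evenPart-⊖-comb r as) (evenPart-∣ₚ (r ∘x² ⊖ comb as) f₂∣r∘x²-as)) ,
    (λ as r f∣r-as → IsIntegral-of-∘x² r
      (integral (spread as) (r ∘x²) (∣ₚ-resp-≅ f₂ (∘x²-⊖-comb r as) (∘x²-∣ₚ (r ⊖ comb as) f∣r-as)))) ,
    (λ as f∣as → All-spread⁻ as
      (independent (spread as) (∣ₚ-resp-≅ f₂ (≅-sym (comb-spread as)) (∘x²-∣ₚ (comb as) f∣as))))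
    where
    evenPart-⊖-comb : ∀ r as → evenPart (r ∘x² ⊖ comb as) ≅ r ⊖ comb (evens as)
    evenPart-⊖-comb r as = ≅-trans (evenPart-⊖ (r ∘x²) (comb as))
      (⊖-cong (evenPart-∘x² r) (≅-sym (comb-evens as)))
    ∘x²-⊖-comb : ∀ r as → (r ⊖ comb as) ∘x² ≅ r ∘x² ⊖ comb (spread as)
    ∘x²-⊖-comb r as = ≅-trans (∘x²-⊖ r (comb as)) (⊖-cong ≅-refl (≅-sym (comb-spread as)))

-- The family F

coeffᶻ : List ℤ → ℕ → ℤ
coeffᶻ []      i       = + 0
coeffᶻ (a ∷ p) zero    = a
coeffᶻ (a ∷ p) (suc i) = coeffᶻ p i

coeff-toℚ[x] : ∀ p i → coeff (toℚ[x] p) i ≡ toℚ (coeffᶻ p i)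
coeff-toℚ[x] []      i       = refl
coeff-toℚ[x] (a ∷ p) zero    = refl
coeff-toℚ[x] (a ∷ p) (suc i) = coeff-toℚ[x] p i

coeffᶻ-⊕ᶻ : ∀ p q i → coeffᶻ (p ⊕ᶻ q) i ≡ coeffᶻ p i ℤ.+ coeffᶻ q i
coeffᶻ-⊕ᶻ []      q       i       = sym (ℤₚ.+-identityˡ _)
coeffᶻ-⊕ᶻ (a ∷ p) []      i       = sym (ℤₚ.+-identityʳ _)
coeffᶻ-⊕ᶻ (a ∷ p) (b ∷ q) zero    = refl
coeffᶻ-⊕ᶻ (a ∷ p) (b ∷ q) (suc i) = coeffᶻ-⊕ᶻ p q i

record _∘x²≈ᶻ_ (q p : List ℤ) : Set where
  field
    at-even : ∀ i → coeffᶻ p (double i) ≡ coeffᶻ q i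
    at-odd  : ∀ i → coeffᶻ p (suc (double i)) ≡ + 0
open _∘x²≈ᶻ_

toℚ[x]-∘x² : ∀ {q p} → q ∘x²≈ᶻ p → toℚ[x] p ≅ toℚ[x] q ∘x²
toℚ[x]-∘x² {q} {p} q∘x²≈p = ≅-∘x² (toℚ[x] q)
  (λ i → trans (coeff-toℚ[x] p (double i)) (trans (cong toℚ (at-even q∘x²≈p i)) (sym (coeff-toℚ[x] q i))))
  (λ i → trans (coeff-toℚ[x] p (suc (double i))) (cong toℚ (at-odd q∘x²≈p i)))

⊕ᶻ-∘x² : ∀ {q p q′ p′} → q ∘x²≈ᶻ p → q′ ∘x²≈ᶻ p′ → (q ⊕ᶻ q′) ∘x²≈ᶻ (p ⊕ᶻ p′)
⊕ᶻ-∘x² {q} {p} {q′} {p′} e e′ = record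
  { at-even = λ i → trans (coeffᶻ-⊕ᶻ p p′ (double i))
      (trans (cong₂ ℤ._+_ (at-even e i) (at-even e′ i)) (sym (coeffᶻ-⊕ᶻ q q′ i)))
  ; at-odd = λ i → trans (coeffᶻ-⊕ᶻ p p′ (suc (double i))) (cong₂ ℤ._+_ (at-odd e i) (at-odd e′ i))
  }

monoᶻ-∘x² : ∀ c k → monoᶻ c k ∘x²≈ᶻ monoᶻ c (double k)
monoᶻ-∘x² c k = record { at-even = even-at k ; at-odd = odd-at k }
  where
  even-at : ∀ k i → coeffᶻ (monoᶻ c (double k)) (double i) ≡ coeffᶻ (monoᶻ c k) i
  even-at zero    zero    = refl
  even-at zero    (suc i) = refl
  even-at (suc k) zero    = refl
  even-at (suc k) (suc i) = even-at k i
  odd-at : ∀ k i → coeffᶻ (monoᶻ c (double k)) (suc (double i)) ≡ + 0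
  odd-at zero    i       = refl
  odd-at (suc k) zero    = refl
  odd-at (suc k) (suc i) = odd-at k i

monoᶻ-∘x²′ : ∀ c k {e} → e ≡ double k → monoᶻ c k ∘x²≈ᶻ monoᶻ c e
monoᶻ-∘x²′ c k refl = monoᶻ-∘x² c k

2^suc≡double : ∀ m → 2 ^ suc m ≡ double (2 ^ m)
2^suc≡double m = sym (double≡2* (2 ^ m))

3*2^suc≡double : ∀ m → 3 ℕ.* 2 ^ suc m ≡ double (3 ℕ.* 2 ^ m)
3*2^suc≡double m = begin
  3 ℕ.* (2 ℕ.* 2 ^ m)   ≡⟨ ℕₚ.*-assoc 3 2 (2 ^ m) ⟨
  6 ℕ.* 2 ^ m           ≡⟨ ℕₚ.*-assoc 2 3 (2 ^ m) ⟩
  2 ℕ.* (3 ℕ.* 2 ^ m)   ≡⟨ double≡2* (3 ℕ.* 2 ^ m) ⟨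
  double (3 ℕ.* 2 ^ m)  ∎
  where open ≡-Reasoning

F-∘x² : ∀ k A B → toℚ[x] (F (3 ℕ.+ k) A B) ≅ toℚ[x] (F (2 ℕ.+ k) A B) ∘x²
F-∘x² k A B = toℚ[x]-∘x²
  (⊕ᶻ-∘x² (monoᶻ-∘x²′ (+ 1) _ (2^suc≡double (2 ℕ.+ k)))
  (⊕ᶻ-∘x² (monoᶻ-∘x²′ A _ (3*2^suc≡double k))
  (⊕ᶻ-∘x² (monoᶻ-∘x²′ B _ (2^suc≡double (suc k)))
  (⊕ᶻ-∘x² (monoᶻ-∘x²′ A _ (2^suc≡double k))
          (monoᶻ-∘x² (+ 1) 0)))))

length-monoᶻ : ∀ c k → length (monoᶻ c k) ≡ suc k
length-monoᶻ c zero    = refl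
length-monoᶻ c (suc k) = cong suc (length-monoᶻ c k)

length-⊕ᶻ-≤ : ∀ {b} p q → length p ≤ b → length q ≤ b → length (p ⊕ᶻ q) ≤ b
length-⊕ᶻ-≤ []      q       p≤b       q≤b       = q≤b
length-⊕ᶻ-≤ (a ∷ p) []      p≤b       q≤b       = p≤b
length-⊕ᶻ-≤ (a ∷ p) (c ∷ q) (s≤s p≤b) (s≤s q≤b) = s≤s (length-⊕ᶻ-≤ p q p≤b q≤b)

∷ʳ-⊕ᶻ-shorter : ∀ g c q → length q ≤ length g →
  ∃ λ g′ → (g ++ c ∷ []) ⊕ᶻ q ≡ g′ ++ c ∷ [] × length g′ ≡ length g
∷ʳ-⊕ᶻ-shorter []      c []      q≤g       = [] , refl , refl
∷ʳ-⊕ᶻ-shorter (a ∷ g) c []      q≤g       = a ∷ g , refl , refl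
∷ʳ-⊕ᶻ-shorter (a ∷ g) c (b ∷ q) (s≤s q≤g) =
  let g′ , sum≡ , length≡ = ∷ʳ-⊕ᶻ-shorter g c q q≤g
  in a ℤ.+ b ∷ g′ , cong (a ℤ.+ b ∷_) sum≡ , cong suc length≡

F-monic : ∀ k A B → ∃ λ g → F (2 ℕ.+ k) A B ≡ g ++ + 1 ∷ [] × length g ≡ 2 ^ (2 ℕ.+ k)
F-monic k A B =
  let g , F≡ , length≡ = ∷ʳ-⊕ᶻ-shorter (replicate d (+ 0)) (+ 1) lower
        (subst (length lower ≤_) (sym (Listₚ.length-replicate d)) lower-short)
  in g , F≡ , trans length≡ (Listₚ.length-replicate d)
  where
  d = 2 ^ (2 ℕ.+ k)
  lower = monoᶻ A (3 ℕ.* 2 ^ k) ⊕ᶻ (monoᶻ B (2 ^ suc k) ⊕ᶻ (monoᶻ A (2 ^ k) ⊕ᶻ monoᶻ (+ 1) 0))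
  below-d : ∀ c e → e < d → length (monoᶻ c e) ≤ d
  below-d c e e<d = subst (_≤ d) (sym (length-monoᶻ c e)) e<d
  2^-below-d : ∀ {e} → e < 2 ℕ.+ k → 2 ^ e < d
  2^-below-d = ℕₚ.^-monoʳ-< 2 (s≤s (s≤s z≤n))
  3*2^k<d : 3 ℕ.* 2 ^ k < d
  3*2^k<d = subst (3 ℕ.* 2 ^ k <_) (ℕₚ.*-assoc 2 2 (2 ^ k))
    (ℕₚ.*-monoˡ-< (2 ^ k) {{ℕₚ.m^n≢0 2 k}} {3} {4} (s≤s (s≤s (s≤s (s≤s z≤n)))))
  lower-short : length lower ≤ d
  lower-short =
    length-⊕ᶻ-≤ (monoᶻ A (3 ℕ.* 2 ^ k)) _ (below-d A _ 3*2^k<d)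
    (length-⊕ᶻ-≤ (monoᶻ B (2 ^ suc k)) _ (below-d B _ (2^-below-d (ℕₚ.n<1+n (suc k))))
    (length-⊕ᶻ-≤ (monoᶻ A (2 ^ k)) (monoᶻ (+ 1) 0) (below-d A _ (2^-below-d (ℕₚ.m<n+m k (s≤s z≤n))))
                 (below-d (+ 1) 0 (ℕₚ.m^n>0 2 (2 ℕ.+ k)))))

lemma3p1 : (A B : ℤ) → ¬ (A ≡ + 0) → ¬ (B ≡ + 0) → (n : ℕ) → 3 ≤ n →
    Monogenic (F n A B) → Monogenic (F (n ∸ 1) A B)
lemma3p1 _ _ _ _ (suc (suc zero)) (s≤s (s≤s ())) _
lemma3p1 A B _ _ (suc (suc (suc k))) _ (g₂ , F≡g₂ , irreducible , integralBasis)
  with F-monic k A B | F-monic (suc k) A B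
... | g , F≡g , |g| | h , F≡h , |h| =
  g , F≡g , irreducible-of-∘x² (F-∘x² k A B) irreducible ,
  integralBasis-of-∘x² (F-∘x² k A B) (subst (IsIntegralBasis (toℚ[x] (F (3 ℕ.+ k) A B))) degree integralBasis)
  where
  degree : length g₂ ≡ double (length g)
  degree = begin
    length g₂             ≡⟨ cong length (Listₚ.∷ʳ-injectiveˡ g₂ h (trans (sym F≡g₂) F≡h)) ⟩
    length h              ≡⟨ |h| ⟩
    2 ^ (3 ℕ.+ k)         ≡⟨ 2^suc≡double (2 ℕ.+ k) ⟩
    double (2 ^ (2 ℕ.+ k)) ≡⟨ cong double |g| ⟨
    double (length g)     ∎
    where open ≡-Reasoning
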